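{- Let $k\ge1$ be an integer and $n\ge1$. For the equivalence relation $\equiv_k$ on $\mathfrak S_n$, the minimal elements (for the lexicographic order) of the equivalence classes are exactly the permutations $\sigma$ such that no $i$ satisfies $\sigma_i-\sigma_{i+1}\ge k$; the maximal elements (for the lexicographic order) of the classes are exactly the permutations $\sigma$ such that no $i$ satisfies $\sigma_{i+1}-\sigma_i\ge k$. Moreover, the set of maximal elements is the image of the set of minimal elements under the map $\tau\mapsto(n+1-\tau_1,\dots,n+1-\tau_n)$.
   Context: For $\pi\in\mathfrak S_n$, extend $\pi$ to a bijection of $\mathbb Z$ by $\pi(j)=j$ for $j\notin[1,n]$, and let $\mathrm{DC}_k(\pi)=d_1\cdots d_n$ with $d_i=1+\#\{j: i-k+1\le j\le i-1,\ \pi(j)<\pi(i)\}$. The $k$-recoil code is $\mathrm{RC}_k(\pi)=\mathrm{DC}_k(\pi^{ -1})$, and $\sigma\equiv_k\tau$ means $\mathrm{RC}_k(\sigma)=\mathrm{RC}_k(\tau)$ (equivalently, for every $i$, the subwords of $\sigma$ and $\tau$ formed by the values in $[i,i+k-1]$ have the same standardization). -}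

module Defs where

open import Data.Nat as ℕ using (ℕ; zero; suc; _+_; _∸_; _<_; _≤_)
open import Data.Nat.Properties as ℕP using ()
open import Data.Integer as ℤ using (ℤ; +_; -[1+_])
open import Data.Integer.Properties as ℤP using ()
open import Data.Fin as Fin using (Fin; toℕ; fromℕ<)
open import Data.Fin.Permutation using (Permutation′; _⟨$⟩ʳ_; flip)
open import Data.List using (List; length; filter; map; upTo)
open import Data.Product using (Σ; _×_; _,_)
open import Data.Sum using (_⊎_)
open import Relation.Nullary using (¬_; yes; no)
open import Relation.Binary.PropositionalEquality using (_≡_)

-- One-line notation: position i (0-based Fin n, i.e. paper position toℕ i + 1)
-- carries the value σ_{i+1} ∈ [1, n].
oneLine : {n : ℕ} → Permutation′ n → Fin n → ℕ
oneLine σ i = suc (toℕ (σ ⟨$⟩ʳ i))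

ext : {n : ℕ} → Permutation′ n → ℤ → ℤ
ext {n} π (+ zero) = + zero
ext {n} π (+ suc m) with m ℕP.<? n
... | yes m<n = + oneLine π (fromℕ< m<n)
... | no  _   = + suc m
ext {n} π -[1+ m ] = -[1+ m ]

-- d_i = 1 + #{ j : i-k+1 ≤ j ≤ i-1, π(j) < π(i) }, the list of j being
-- i-1, i-2, ..., i-(k-1) (as integers).
DC : (k : ℕ) → {n : ℕ} → Permutation′ n → Fin n → ℕ
DC k π i = suc (length (filter (λ j → ext π j ℤP.<? ext π pos) js))
  where
    pos : ℤ
    pos = + suc (toℕ i)
    js : List ℤ
    js = map (λ t → pos ℤ.- (+ suc t)) (upTo (k ∸ 1))

RC : (k : ℕ) → {n : ℕ} → Permutation′ n → Fin n → ℕ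
RC k π = DC k (flip π)

_≡[_]_ : {n : ℕ} → Permutation′ n → ℕ → Permutation′ n → Set
σ ≡[ k ] τ = ∀ i → RC k σ i ≡ RC k τ i

_≤lex_ : {n : ℕ} → Permutation′ n → Permutation′ n → Set
_≤lex_ {n} σ τ =
  (∀ i → oneLine σ i ≡ oneLine τ i) ⊎
  Σ (Fin n) (λ i → (∀ j → toℕ j < toℕ i → oneLine σ j ≡ oneLine τ j)
                   × oneLine σ i < oneLine τ i)

IsMinInClass : (k : ℕ) → {n : ℕ} → Permutation′ n → Set
IsMinInClass k σ = ∀ τ → τ ≡[ k ] σ → σ ≤lex τ

IsMaxInClass : (k : ℕ) → {n : ℕ} → Permutation′ n → Set
IsMaxInClass k σ = ∀ τ → τ ≡[ k ] σ → τ ≤lex σ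

-- No i (1 ≤ i < n) with σ_i - σ_{i+1} ≥ k, i.e. σ_i ≥ σ_{i+1} + k.
-- Here i is 0-based: positions i and i+1 with i+1 < n.
NoBigDescent : (k : ℕ) → {n : ℕ} → Permutation′ n → Set
NoBigDescent k {n} σ = (i : ℕ) → (h : suc i < n) →
  ¬ (oneLine σ (fromℕ< h) + k ≤ oneLine σ (fromℕ< (ℕP.<-trans (ℕP.n<1+n i) h)))

NoBigAscent : (k : ℕ) → {n : ℕ} → Permutation′ n → Set
NoBigAscent k {n} σ = (i : ℕ) → (h : suc i < n) →
  ¬ (oneLine σ (fromℕ< (ℕP.<-trans (ℕP.n<1+n i) h)) + k ≤ oneLine σ (fromℕ< h))

-- Two permutations are k-recoil equivalent exactly when every two values at distance less than k
-- occur in the same relative order in both: the recoil code at b counts the values just below b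
-- that precede it, and conversely determines their order by induction on b. Hence adjacent entries
-- differing by at least k can be swapped inside a class, so a lexicographically minimal (maximal)
-- element has no such descent (ascent). Conversely, if σ has no big descent and τ ≡ₖ σ were
-- lexicographically smaller, the first entry a of τ below the corresponding entry of σ would be
-- preceded in σ by some value in (a, a + k), which τ places after a. Complementing the values
-- preserves ≡ₖ and reverses the lexicographic order, which turns minima into maxima.
module Submission where

open import Defs
open import Data.Nat using (ℕ; suc; _≤_; _∸_)
open import Data.Fin.Permutation using (Permutation′)
open import Data.Product using (Σ; _×_)
open import Function.Bundles using (_⇔_)
open import Relation.Binary.PropositionalEquality using (_≡_)

open import Data.Nat using (zero; _+_; _<_; z≤n; s≤s; s≤s⁻¹; z<s; s<s; s<s⁻¹; _<?_)
open import Data.Nat.Properties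
open import Data.Integer as ℤ using (ℤ; +_; -[1+_]; _⊖_; +≤+; +<+)
open import Data.Integer.Properties as ℤP using ([1+m]⊖[1+n]≡m⊖n; ⊖-≥; ⊖-≤; neg-≤-pos; drop‿+<+)
open import Data.Fin as Fin using (Fin; toℕ; fromℕ<; opposite)
open import Data.Fin.Properties
  using (toℕ<n; toℕ-injective; toℕ-fromℕ<; fromℕ<-toℕ; opposite-prop)
  renaming (_≟_ to _≟ᶠ_)
open import Data.Fin.Permutation using (_⟨$⟩ʳ_; _⟨$⟩ˡ_; flip; inverseˡ; inverseʳ; _∘ₚ_; transpose; reverse)
import Data.Fin.Permutation.Components as PC
open import Data.List using (List; []; _∷_; length; filter; map; upTo)
open import Data.List.Membership.Propositional using (_∈_)
open import Data.List.Membership.Propositional.Properties using (∈-map⁺; ∈-map⁻; ∈-upTo⁺; ∈-upTo⁻)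
open import Data.List.Relation.Unary.Any using (here; there)
open import Data.Product using (_,_)
open import Data.Sum using (_⊎_; inj₁; inj₂)
open import Function using (_∘_)
open import Function.Bundles using (mk⇔; module Equivalence)
open import Relation.Binary.Definitions using (DecidableEquality; tri<; tri≈; tri>)
open import Relation.Binary.PropositionalEquality
  using (_≢_; refl; sym; trans; cong; subst; subst₂; module ≡-Reasoning)
open import Relation.Nullary using (¬_; Dec; yes; no; contradiction)
open import Relation.Nullary.Decidable using (dec-true; dec-false)
open import Relation.Unary using (Decidable)

open Equivalence using (to; from)

private
  variable
    n k m : ℕ

module _ {A : Set} {P Q : A → Set} (P? : Decidable P) (Q? : Decidable Q) where

  length-filter-mono : ∀ xs → (∀ {x} → x ∈ xs → P x → Q x) →
                       length (filter P? xs) ≤ length (filter Q? xs)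
  length-filter-mono []       P⇒Q = z≤n
  length-filter-mono (x ∷ xs) P⇒Q with P? x | Q? x
  ... | yes _  | yes _  = s≤s (length-filter-mono xs (P⇒Q ∘ there))
  ... | yes px | no ¬qx = contradiction (P⇒Q (here refl) px) ¬qx
  ... | no _   | yes _  = m≤n⇒m≤1+n (length-filter-mono xs (P⇒Q ∘ there))
  ... | no _   | no _   = length-filter-mono xs (P⇒Q ∘ there)

  length-filter-mono-< : ∀ xs → (∀ {x} → x ∈ xs → P x → Q x) →
                         ∀ {y} → y ∈ xs → Q y → ¬ P y →
                         length (filter P? xs) < length (filter Q? xs)
  length-filter-mono-< (x ∷ xs) P⇒Q (here refl) qy ¬py with P? x | Q? x
  ... | yes py | _      = contradiction py ¬py
  ... | no _   | yes _  = s≤s (length-filter-mono xs (P⇒Q ∘ there))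
  ... | no _   | no ¬qy = contradiction qy ¬qy
  length-filter-mono-< (x ∷ xs) P⇒Q (there y∈) qy ¬py with P? x | Q? x
  ... | yes _  | yes _  = s≤s (length-filter-mono-< xs (P⇒Q ∘ there) y∈ qy ¬py)
  ... | yes px | no ¬qx = contradiction (P⇒Q (here refl) px) ¬qx
  ... | no _   | yes _  = m≤n⇒m≤1+n (length-filter-mono-< xs (P⇒Q ∘ there) y∈ qy ¬py)
  ... | no _   | no _   = length-filter-mono-< xs (P⇒Q ∘ there) y∈ qy ¬py

position : Permutation′ n → Fin n → ℕ
position σ v = toℕ (σ ⟨$⟩ˡ v)

position≡⇒value : (σ : Permutation′ n) {v i : Fin n} → position σ v ≡ toℕ i → σ ⟨$⟩ʳ i ≡ v
position≡⇒value σ e = trans (cong (σ ⟨$⟩ʳ_) (sym (toℕ-injective e))) (inverseʳ σ)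

position-injective : (σ : Permutation′ n) {a b : Fin n} → position σ a ≡ position σ b → a ≡ b
position-injective σ e = trans (sym (position≡⇒value σ refl)) (position≡⇒value σ (sym e))

position-≮⇒> : (σ : Permutation′ n) {a b : Fin n} → a ≢ b →
               ¬ (position σ a < position σ b) → position σ b < position σ a
position-≮⇒> σ a≢b a≮b = ≤∧≢⇒< (≮⇒≥ a≮b) (a≢b ∘ position-injective σ ∘ sym)

position-<-converse : (σ τ : Permutation′ n) {a b : Fin n} → a ≢ b →
  (position τ b < position τ a → position σ b < position σ a) →
  position σ a < position σ b → position τ a < position τ b
position-<-converse σ τ {a} {b} a≢b back σab with position τ a <? position τ b
... | yes τab = τab
... | no  ¬τab = contradiction (back (position-≮⇒> τ a≢b ¬τab)) (<-asym σab)

Near : ℕ → Fin n → Fin n → Set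
Near k a b = toℕ a < toℕ b + k × toℕ b < toℕ a + k

near-sym : {a b : Fin n} → Near k a b → Near k b a
near-sym (a<b+k , b<a+k) = b<a+k , a<b+k

<⇒near : {a b : Fin n} → toℕ a < toℕ b → toℕ b < toℕ a + k → Near k a b
<⇒near {k = k} a<b b<a+k = <-≤-trans a<b (m≤m+n _ k) , b<a+k

PreservesNearOrderBelow : ℕ → ℕ → Permutation′ n → Permutation′ n → Set
PreservesNearOrderBelow {n} k m σ τ = ∀ (a b : Fin n) → toℕ a < m → toℕ b < m → Near k a b →
  position σ a < position σ b → position τ a < position τ b

PreservesNearOrder : ℕ → Permutation′ n → Permutation′ n → Set
PreservesNearOrder {n} k = PreservesNearOrderBelow k n

nearOrder-sym : (σ τ : Permutation′ n) →
                PreservesNearOrderBelow k m σ τ → PreservesNearOrderBelow k m τ σ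
nearOrder-sym σ τ pres a b a<m b<m near τab =
  position-<-converse τ σ a≢b (pres b a b<m a<m (near-sym near)) τab
  where
  a≢b : a ≢ b
  a≢b refl = <-irrefl refl τab

pointℤ : Fin n → ℤ
pointℤ v = + suc (toℕ v)

window : ℕ → ℤ → List ℤ
window k y = map (λ t → y ℤ.- + suc t) (upTo (k ∸ 1))

Below : Permutation′ n → ℤ → ℤ → Set
Below σ y x = ext (flip σ) x ℤ.< ext (flip σ) y

below? : (σ : Permutation′ n) (y : ℤ) → Decidable (Below σ y)
below? σ y x = ext (flip σ) x ℤ.<? ext (flip σ) y

-- RC k σ b is definitionally suc (windowCount k σ b). The window holds pointℤ b − 1, …,
-- pointℤ b − (k − 1), possibly nonpositive, and ext (flip σ) sends a 1-based value to its position.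
windowCount : ℕ → Permutation′ n → Fin n → ℕ
windowCount k σ b = length (filter (below? σ (pointℤ b)) (window k (pointℤ b)))

ext-pointℤ : (π : Permutation′ n) (v : Fin n) → ext π (pointℤ v) ≡ pointℤ (π ⟨$⟩ʳ v)
ext-pointℤ {n} π v with toℕ v <? n
... | yes v<n = cong (λ w → pointℤ (π ⟨$⟩ʳ w)) (fromℕ<-toℕ v v<n)
... | no  v≮n = contradiction (toℕ<n v) v≮n

ext-nonpositive : (π : Permutation′ n) {x : ℤ} → x ℤ.≤ + 0 → ext π x ≡ x
ext-nonpositive π {+ zero}   _ = refl
ext-nonpositive π { -[1+ _ ]} _ = refl
ext-nonpositive π {+ suc _}  (+≤+ ())

below-pointℤ : (σ : Permutation′ n) (a b : Fin n) →
               Below σ (pointℤ b) (pointℤ a) ⇔ position σ a < position σ b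
below-pointℤ σ a b rewrite ext-pointℤ (flip σ) a | ext-pointℤ (flip σ) b =
  mk⇔ (s<s⁻¹ ∘ drop‿+<+) (+<+ ∘ s<s)

below-nonpositive : (σ : Permutation′ n) (b : Fin n) {x : ℤ} → x ℤ.≤ + 0 → Below σ (pointℤ b) x
below-nonpositive σ b x≤0 rewrite ext-nonpositive (flip σ) x≤0 | ext-pointℤ (flip σ) b =
  ℤP.≤-<-trans x≤0 (+<+ z<s)

pointℤ-minus : (b : Fin n) (t : ℕ) → pointℤ b ℤ.- + suc t ≡ toℕ b ⊖ t
pointℤ-minus b t = [1+m]⊖[1+n]≡m⊖n (toℕ b) t

<∸1⇒suc< : ∀ {t} → t < k ∸ 1 → suc t < k
<∸1⇒suc< {k = suc _} t<k-1 = s<s t<k-1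

suc<⇒<∸1 : ∀ {t} → suc t < k → t < k ∸ 1
suc<⇒<∸1 {k = suc _} 1+t<k = s<s⁻¹ 1+t<k

window-view : (k : ℕ) (b : Fin n) {x : ℤ} → x ∈ window k (pointℤ b) →
  x ℤ.≤ + 0 ⊎ Σ (Fin n) (λ w → x ≡ pointℤ w × toℕ w < toℕ b × toℕ b < toℕ w + k)
window-view {n} k b x∈ with ∈-map⁻ (λ t → pointℤ b ℤ.- + suc t) x∈
... | t , t∈ , refl with t <? toℕ b
...   | no t≮b =
        inj₁ (subst (ℤ._≤ + 0) (sym (trans (pointℤ-minus b t) (⊖-≤ (≮⇒≥ t≮b)))) neg-≤-pos)
...   | yes t<b = inj₂ (w , x≡w , w<b , b<w+k)
  where
  open ≡-Reasoning
  B = toℕ b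
  w : Fin n
  w = fromℕ< (≤-<-trans (m∸n≤m B (suc t)) (toℕ<n b))
  x≡w : pointℤ b ℤ.- + suc t ≡ pointℤ w
  x≡w = begin
    pointℤ b ℤ.- + suc t ≡⟨ pointℤ-minus b t ⟩
    B ⊖ t                ≡⟨ ⊖-≥ (<⇒≤ t<b) ⟩
    + (B ∸ t)            ≡⟨ cong +_ (+-∸-assoc 1 t<b) ⟩
    + suc (B ∸ suc t)    ≡⟨ cong (+_ ∘ suc) (toℕ-fromℕ< _) ⟨
    pointℤ w             ∎
  w<b : toℕ w < B
  w<b = subst (_< B) (sym (toℕ-fromℕ< _)) (∸-monoʳ-< z<s t<b)
  b<w+k : B < toℕ w + k
  b<w+k = subst (λ c → B < c + k) (sym (toℕ-fromℕ< _))
            (subst (_< (B ∸ suc t) + k) (m∸n+n≡m t<b)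
              (+-monoʳ-< (B ∸ suc t) (<∸1⇒suc< (∈-upTo⁻ t∈))))

window-∈ : (k : ℕ) {a b : Fin n} → toℕ a < toℕ b → toℕ b < toℕ a + k →
           pointℤ a ∈ window k (pointℤ b)
window-∈ k {a} {b} a<b b<a+k =
  subst (_∈ window k (pointℤ b)) b-[t+1]≡a (∈-map⁺ (λ t → pointℤ b ℤ.- + suc t) (∈-upTo⁺ t<k-1))
  where
  A = toℕ a
  B = toℕ b
  t = B ∸ suc A
  t<k-1 : t < k ∸ 1
  t<k-1 = suc<⇒<∸1 (begin-strict
    suc t     ≡⟨ +-∸-assoc 1 a<b ⟨
    B ∸ A     <⟨ ∸-monoˡ-< b<a+k (<⇒≤ a<b) ⟩
    A + k ∸ A ≡⟨ m+n∸m≡n A k ⟩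
    k         ∎)
    where open ≤-Reasoning
  b-[t+1]≡a : pointℤ b ℤ.- + suc t ≡ pointℤ a
  b-[t+1]≡a = begin
    pointℤ b ℤ.- + suc t ≡⟨ pointℤ-minus b t ⟩
    B ⊖ t                ≡⟨ ⊖-≥ (m∸n≤m B (suc A)) ⟩
    + (B ∸ t)            ≡⟨ cong +_ (m∸[m∸n]≡n a<b) ⟩
    pointℤ a             ∎
    where open ≡-Reasoning

windowCount-mono : (σ τ : Permutation′ n) → PreservesNearOrder k σ τ → (b : Fin n) →
                   windowCount k σ b ≤ windowCount k τ b
windowCount-mono {k = k} σ τ pres b =
  length-filter-mono (below? σ (pointℤ b)) (below? τ (pointℤ b)) (window k (pointℤ b)) σ⇒τ
  where
  σ⇒τ : ∀ {x} → x ∈ window k (pointℤ b) → Below σ (pointℤ b) x → Below τ (pointℤ b) x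
  σ⇒τ x∈ σx with window-view k b x∈
  ... | inj₁ x≤0 = below-nonpositive τ b x≤0
  ... | inj₂ (w , refl , w<b , b<w+k) = from (below-pointℤ τ w b)
        (pres w b (toℕ<n w) (toℕ<n b) (<⇒near w<b b<w+k) (to (below-pointℤ σ w b) σx))

nearOrder⇒recoilEq : (σ τ : Permutation′ n) → PreservesNearOrder k σ τ → σ ≡[ k ] τ
nearOrder⇒recoilEq σ τ pres b =
  cong suc (≤-antisym (windowCount-mono σ τ pres b) (windowCount-mono τ σ (nearOrder-sym σ τ pres) b))

-- If τ put b before a, every value counted at b for τ would be counted for σ (by the hypothesis on
-- pairs below b), and a only for σ, so the recoil codes would differ at b.
recoilEq⇒nearOrder-top : (σ τ : Permutation′ n) → σ ≡[ k ] τ → {a b : Fin n} →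
  PreservesNearOrderBelow k (toℕ b) τ σ → toℕ a < toℕ b → toℕ b < toℕ a + k →
  position σ a < position σ b → position τ a < position τ b
recoilEq⇒nearOrder-top {k = k} σ τ σ≡τ {a} {b} below a<b b<a+k σab
  with position τ a <? position τ b
... | yes τab = τab
... | no  ¬τab = contradiction (suc-injective (σ≡τ b)) (<⇒≢ τ<σ ∘ sym)
  where
  τba : position τ b < position τ a
  τba = position-≮⇒> τ (λ { refl → <-irrefl refl a<b }) ¬τab
  τ⇒σ : ∀ {x} → x ∈ window k (pointℤ b) → Below τ (pointℤ b) x → Below σ (pointℤ b) x
  τ⇒σ x∈ τx with window-view k b x∈
  ... | inj₁ x≤0 = below-nonpositive σ b x≤0
  ... | inj₂ (w , refl , w<b , b<w+k) = from (below-pointℤ σ w b) (<-trans σwa σab)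
    where
    σwa : position σ w < position σ a
    σwa = below w a w<b a<b (<-trans w<b b<a+k , <-trans a<b b<w+k)
                (<-trans (to (below-pointℤ τ w b) τx) τba)
  τ<σ : windowCount k τ b < windowCount k σ b
  τ<σ = length-filter-mono-< (below? τ (pointℤ b)) (below? σ (pointℤ b)) (window k (pointℤ b)) τ⇒σ
          (window-∈ k a<b b<a+k)
          (from (below-pointℤ σ a b) σab) (¬τab ∘ to (below-pointℤ τ a b))

recoilEq⇒nearOrderBelow : ∀ m (σ τ : Permutation′ n) → σ ≡[ k ] τ → PreservesNearOrderBelow k m σ τ
recoilEq⇒nearOrderBelow zero σ τ σ≡τ a b () _
recoilEq⇒nearOrderBelow (suc m) σ τ σ≡τ a b a<1+m b<1+m near@(a<b+k , b<a+k)
  with m<1+n⇒m<n∨m≡n a<1+m | m<1+n⇒m<n∨m≡n b<1+m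
... | inj₁ a<m | inj₁ b<m = recoilEq⇒nearOrderBelow m σ τ σ≡τ a b a<m b<m near
... | inj₁ a<m | inj₂ refl =
      recoilEq⇒nearOrder-top σ τ σ≡τ (recoilEq⇒nearOrderBelow m τ σ (sym ∘ σ≡τ)) a<m b<a+k
... | inj₂ refl | inj₁ b<m =
      position-<-converse σ τ (λ { refl → <-irrefl refl b<m })
        (recoilEq⇒nearOrder-top τ σ (sym ∘ σ≡τ) (recoilEq⇒nearOrderBelow m σ τ σ≡τ) b<m a<b+k)
... | inj₂ refl | inj₂ b≡a = λ σab →
      contradiction σab (<-irrefl (cong (position σ) (toℕ-injective (sym b≡a))))

recoilEq⇒nearOrder : (σ τ : Permutation′ n) → σ ≡[ k ] τ → PreservesNearOrder k σ τ
recoilEq⇒nearOrder σ τ = recoilEq⇒nearOrderBelow _ σ τ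

AgreeBefore : Permutation′ n → Permutation′ n → Fin n → Set
AgreeBefore {n} σ τ i = ∀ (j : Fin n) → toℕ j < toℕ i → oneLine σ j ≡ oneLine τ j

_<lex_ : Permutation′ n → Permutation′ n → Set
_<lex_ {n} σ τ = Σ (Fin n) λ i → AgreeBefore σ τ i × oneLine σ i < oneLine τ i

agreeBefore-sym : (σ τ : Permutation′ n) {i : Fin n} → AgreeBefore σ τ i → AgreeBefore τ σ i
agreeBefore-sym σ τ agree j j<i = sym (agree j j<i)

firstDifference : {A : Set} → DecidableEquality A → (f g : Fin n → A) →
  (∀ i → f i ≡ g i) ⊎ Σ (Fin n) (λ i → (∀ j → toℕ j < toℕ i → f j ≡ g j) × f i ≢ g i)
firstDifference {zero}  _≟_ f g = inj₁ λ ()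
firstDifference {suc n} _≟_ f g with f Fin.zero ≟ g Fin.zero
... | no f0≢g0 = inj₂ (Fin.zero , (λ _ ()) , f0≢g0)
... | yes f0≡g0 with firstDifference _≟_ (f ∘ Fin.suc) (g ∘ Fin.suc)
...   | inj₁ same = inj₁ λ { Fin.zero → f0≡g0 ; (Fin.suc i) → same i }
...   | inj₂ (i , agree , fi≢gi) =
        inj₂ (Fin.suc i , (λ { Fin.zero _ → f0≡g0 ; (Fin.suc j) j<i → agree j (s<s⁻¹ j<i) }) , fi≢gi)

≤lex⊎>lex : (σ τ : Permutation′ n) → σ ≤lex τ ⊎ τ <lex σ
≤lex⊎>lex σ τ with firstDifference _≟_ (oneLine σ) (oneLine τ)
... | inj₁ same = inj₁ (inj₁ same)
... | inj₂ (i , agree , σi≢τi) with <-cmp (oneLine σ i) (oneLine τ i)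
...   | tri< σi<τi _ _ = inj₁ (inj₂ (i , agree , σi<τi))
...   | tri≈ _ σi≡τi _ = contradiction σi≡τi σi≢τi
...   | tri> _ _ τi<σi = inj₂ (i , agreeBefore-sym σ τ agree , τi<σi)

<lex⇒≱lex : (σ τ : Permutation′ n) → τ <lex σ → ¬ (σ ≤lex τ)
<lex⇒≱lex σ τ (i , _ , τi<σi) (inj₁ same) = <-irrefl (sym (same i)) τi<σi
<lex⇒≱lex σ τ (i , agree , τi<σi) (inj₂ (j , agree′ , σj<τj)) with <-cmp (toℕ j) (toℕ i)
... | tri< j<i _ _ = <-irrefl (sym (agree j j<i)) σj<τj
... | tri≈ _ j≡i _ =
      <-asym τi<σi (subst (λ x → oneLine σ x < oneLine τ x) (toℕ-injective j≡i) σj<τj)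
... | tri> _ _ i<j = <-irrefl (sym (agree′ i i<j)) τi<σi

agreeBefore-position : (σ τ : Permutation′ n) {i c : Fin n} → AgreeBefore σ τ i →
                       position τ c < toℕ i → position σ c ≡ position τ c
agreeBefore-position σ τ {c = c} agree τc<i = cong toℕ (begin
  σ ⟨$⟩ˡ c               ≡⟨ cong (σ ⟨$⟩ˡ_) σq≡c ⟨
  σ ⟨$⟩ˡ (σ ⟨$⟩ʳ q)       ≡⟨ inverseˡ σ ⟩
  q                      ∎)
  where
  open ≡-Reasoning
  q = τ ⟨$⟩ˡ c
  σq≡c : σ ⟨$⟩ʳ q ≡ c
  σq≡c = trans (toℕ-injective (suc-injective (agree q τc<i))) (inverseʳ τ)

agreeBefore-position-≥ : (σ τ : Permutation′ n) {i c : Fin n} → AgreeBefore σ τ i →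
                         toℕ i ≤ position σ c → toℕ i ≤ position τ c
agreeBefore-position-≥ σ τ {i} agree i≤σc = ≮⇒≥ λ τc<i →
  <⇒≱ (subst (_< toℕ i) (sym (agreeBefore-position σ τ agree τc<i)) τc<i) i≤σc

crossing : (R : ℕ → Set) → Decidable R → ∀ {q p} → q < p → R q → ¬ R p →
           Σ ℕ λ j → q ≤ j × j < p × R j × ¬ R (suc j)
crossing R R? {p = zero}  ()
crossing R R? {q} {suc p} q<1+p Rq ¬R1+p with R? p
... | yes Rp = p , m<1+n⇒m≤n q<1+p , n<1+n p , Rp , ¬R1+p
... | no ¬Rp with crossing R R? (≤∧≢⇒< (m<1+n⇒m≤n q<1+p) λ { refl → ¬Rp Rq }) Rq ¬Rp
...   | j , q≤j , j<p , Rj , ¬R1+j = j , q≤j , m<n⇒m<1+n j<p , Rj , ¬R1+j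

-- The value at position j, with junk value 0 for j ≥ n, so that positions can be scanned in ℕ.
valueAt : Permutation′ n → ℕ → ℕ
valueAt {n} σ j with j <? n
... | yes j<n = toℕ (σ ⟨$⟩ʳ fromℕ< j<n)
... | no  _   = 0

valueAt-fromℕ< : (σ : Permutation′ n) {j : ℕ} (j<n : j < n) → valueAt σ j ≡ toℕ (σ ⟨$⟩ʳ fromℕ< j<n)
valueAt-fromℕ< {n} σ {j} j<n with j <? n
... | yes _   = refl
... | no  j≮n = contradiction j<n j≮n

valueAt-toℕ : (σ : Permutation′ n) (x : Fin n) → valueAt σ (toℕ x) ≡ toℕ (σ ⟨$⟩ʳ x)
valueAt-toℕ σ x =
  trans (valueAt-fromℕ< σ (toℕ<n x)) (cong (toℕ ∘ (σ ⟨$⟩ʳ_)) (fromℕ<-toℕ x (toℕ<n x)))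

-- Walking from position q to the position of a, the values drop from above a to a; at the last
-- step from above a to at most a, the absence of big descents keeps the value below a + k.
noBigDescent⇒nearLargerBefore : (σ : Permutation′ n) → NoBigDescent k σ → (q a : Fin n) →
  toℕ q < position σ a → toℕ a < toℕ (σ ⟨$⟩ʳ q) →
  Σ (Fin n) λ j → toℕ q ≤ toℕ j × toℕ j < position σ a ×
                  toℕ a < toℕ (σ ⟨$⟩ʳ j) × toℕ (σ ⟨$⟩ʳ j) < toℕ a + k
noBigDescent⇒nearLargerBefore {n} {k} σ nbd q a q<p a<σq =
  let (j , q≤j , j<p , a<σj , ¬a<σj+1) =
        crossing Above (λ j → toℕ a <? valueAt σ j) q<p Above-q ¬Above-p
      j+1<n : suc j < n
      j+1<n = ≤-<-trans j<p (toℕ<n (σ ⟨$⟩ˡ a))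
      j<n   = <-trans (n<1+n j) j+1<n
      toℕ-J : toℕ (fromℕ< j<n) ≡ j
      toℕ-J = toℕ-fromℕ< j<n
      σj+1≤a : toℕ (σ ⟨$⟩ʳ fromℕ< j+1<n) ≤ toℕ a
      σj+1≤a = subst (_≤ toℕ a) (valueAt-fromℕ< σ j+1<n) (≮⇒≥ ¬a<σj+1)
      σj<σj+1+k : toℕ (σ ⟨$⟩ʳ fromℕ< j<n) < toℕ (σ ⟨$⟩ʳ fromℕ< j+1<n) + k
      σj<σj+1+k = s<s⁻¹ (≰⇒> (nbd j j+1<n))
  in fromℕ< j<n , subst (toℕ q ≤_) (sym toℕ-J) q≤j , subst (_< position σ a) (sym toℕ-J) j<p ,
     subst (toℕ a <_) (valueAt-fromℕ< σ j<n) a<σj , <-≤-trans σj<σj+1+k (+-monoˡ-≤ k σj+1≤a)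
  where
  Above : ℕ → Set
  Above j = toℕ a < valueAt σ j
  Above-q : Above (toℕ q)
  Above-q = subst (toℕ a <_) (sym (valueAt-toℕ σ q)) a<σq
  ¬Above-p : ¬ Above (position σ a)
  ¬Above-p = <-irrefl (sym (trans (valueAt-toℕ σ (σ ⟨$⟩ˡ a)) (cong toℕ (inverseʳ σ))))

-- Let a = τ(i) be the first entry where τ goes below σ. Then a lies further right in σ, and some
-- value c near above a lies between positions i and a in σ, while in τ it comes after a.
noBigDescent⇒¬>lex : (σ τ : Permutation′ n) → NoBigDescent k σ → PreservesNearOrder k τ σ → ¬ (τ <lex σ)
noBigDescent⇒¬>lex {n} {k} σ τ nbd pres (i , agree , τi<σi) =
  let (j , i≤j , j<p , a<c , c<a+k) = noBigDescent⇒nearLargerBefore σ nbd i a i<p (s<s⁻¹ τi<σi)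
  in <-asym j<p (a-before j i≤j a<c c<a+k)
  where
  a = τ ⟨$⟩ʳ i
  τa≡i : position τ a ≡ toℕ i
  τa≡i = cong toℕ (inverseˡ τ)
  i<p : toℕ i < position σ a
  i<p = ≤∧≢⇒< (agreeBefore-position-≥ τ σ agree (≤-reflexive (sym τa≡i)))
               λ i≡σa → <-irrefl (cong (suc ∘ toℕ) (sym (position≡⇒value σ (sym i≡σa)))) τi<σi
  a-before : (j : Fin n) → toℕ i ≤ toℕ j → toℕ a < toℕ (σ ⟨$⟩ʳ j) → toℕ (σ ⟨$⟩ʳ j) < toℕ a + k →
             position σ a < toℕ j
  a-before j i≤j a<c c<a+k = subst (position σ a <_) σc≡j
    (pres a c (toℕ<n a) (toℕ<n c) (<⇒near a<c c<a+k) (subst (_< position τ c) (sym τa≡i) i<τc))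
    where
    c = σ ⟨$⟩ʳ j
    σc≡j : position σ c ≡ toℕ j
    σc≡j = cong toℕ (inverseˡ σ)
    i<τc : toℕ i < position τ c
    i<τc = ≤∧≢⇒< (agreeBefore-position-≥ σ τ (agreeBefore-sym τ σ agree)
                                           (subst (toℕ i ≤_) (sym σc≡j) i≤j))
                  λ i≡τc → <-irrefl (cong toℕ (position≡⇒value τ (sym i≡τc))) a<c

noBigDescent⇒isMin : (σ : Permutation′ n) → NoBigDescent k σ → IsMinInClass k σ
noBigDescent⇒isMin σ nbd τ τ≡σ with ≤lex⊎>lex σ τ
... | inj₁ σ≤τ = σ≤τ
... | inj₂ τ<σ = contradiction τ<σ (noBigDescent⇒¬>lex σ τ nbd (recoilEq⇒nearOrder τ σ τ≡σ))

transpose-i : (i j : Fin n) → PC.transpose i j i ≡ j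
transpose-i i j rewrite dec-true (i ≟ᶠ i) refl = refl

transpose-j : (i j : Fin n) → PC.transpose i j j ≡ i
transpose-j i j with j ≟ᶠ i
... | yes j≡i = j≡i
... | no  _ rewrite dec-true (j ≟ᶠ j) refl = refl

transpose-other : (i j : Fin n) {x : Fin n} → x ≢ i → x ≢ j → PC.transpose i j x ≡ x
transpose-other i j {x} x≢i x≢j rewrite dec-false (x ≟ᶠ i) x≢i | dec-false (x ≟ᶠ j) x≢j = refl

TransposeCase : Fin n → Fin n → Fin n → Set
TransposeCase i j x =
  x ≡ i × PC.transpose i j x ≡ j ⊎
  x ≡ j × PC.transpose i j x ≡ i ⊎
  x ≢ i × x ≢ j × PC.transpose i j x ≡ x

transpose-cases : (i j x : Fin n) → TransposeCase i j x
transpose-cases i j x = cases (x ≟ᶠ i) (x ≟ᶠ j)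
  where
  cases : Dec (x ≡ i) → Dec (x ≡ j) → TransposeCase i j x
  cases (yes x≡i) _         = inj₁ (x≡i , trans (cong (PC.transpose i j) x≡i) (transpose-i i j))
  cases (no  _)   (yes x≡j) =
    inj₂ (inj₁ (x≡j , trans (cong (PC.transpose i j) x≡j) (transpose-j i j)))
  cases (no  x≢i) (no  x≢j) = inj₂ (inj₂ (x≢i , x≢j , transpose-other i j x≢i x≢j))

transpose-adjacent-< : (i j : Fin n) → toℕ i < toℕ j → toℕ j ≤ suc (toℕ i) → {x y : Fin n} →
  toℕ x < toℕ y → ¬ (x ≡ i × y ≡ j) → toℕ (PC.transpose i j x) < toℕ (PC.transpose i j y)
transpose-adjacent-< i j i<j j≤1+i {x} {y} x<y ¬ij with transpose-cases i j x | transpose-cases i j y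
... | inj₁ (refl , _)           | inj₁ (refl , _)           = contradiction x<y (<-irrefl refl)
... | inj₁ (refl , _)           | inj₂ (inj₁ (refl , _))    = contradiction (refl , refl) ¬ij
... | inj₁ (refl , tx)          | inj₂ (inj₂ (_ , y≢j , ty)) rewrite tx | ty =
      ≤∧≢⇒< (≤-trans j≤1+i x<y) (y≢j ∘ sym ∘ toℕ-injective)
... | inj₂ (inj₁ (refl , _))    | inj₁ (refl , _)           = contradiction x<y (<-asym i<j)
... | inj₂ (inj₁ (refl , _))    | inj₂ (inj₁ (refl , _))    = contradiction x<y (<-irrefl refl)
... | inj₂ (inj₁ (refl , tx))   | inj₂ (inj₂ (_ , _ , ty))  rewrite tx | ty = <-trans i<j x<y
... | inj₂ (inj₂ (_ , _ , tx))  | inj₁ (refl , ty)          rewrite tx | ty = <-trans x<y i<j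
... | inj₂ (inj₂ (x≢i , _ , tx)) | inj₂ (inj₁ (refl , ty))  rewrite tx | ty =
      ≤∧≢⇒< (m<1+n⇒m≤n (<-≤-trans x<y j≤1+i)) (x≢i ∘ toℕ-injective)
... | inj₂ (inj₂ (_ , _ , tx))  | inj₂ (inj₂ (_ , _ , ty))  rewrite tx | ty = x<y

module AdjacentSwap {n : ℕ} (i : ℕ) (i+1<n : suc i < n) where

  left right : Fin n
  left  = fromℕ< (<-trans (n<1+n i) i+1<n)
  right = fromℕ< i+1<n

  toℕ-left : toℕ left ≡ i
  toℕ-left = toℕ-fromℕ< _

  toℕ-right : toℕ right ≡ suc i
  toℕ-right = toℕ-fromℕ< _

  left<right : toℕ left < toℕ right
  left<right = subst₂ _<_ (sym toℕ-left) (sym toℕ-right) (n<1+n i)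

  swapAt : Permutation′ n → Permutation′ n
  swapAt σ = transpose right left ∘ₚ σ

  oneLine-swapAt-left : (σ : Permutation′ n) → oneLine (swapAt σ) left ≡ oneLine σ right
  oneLine-swapAt-left σ = cong (suc ∘ toℕ ∘ (σ ⟨$⟩ʳ_)) (transpose-j right left)

  swapAt-agreeBefore : (σ : Permutation′ n) → AgreeBefore (swapAt σ) σ left
  swapAt-agreeBefore σ j j<left =
    cong (suc ∘ toℕ ∘ (σ ⟨$⟩ʳ_)) (transpose-other right left j≢right j≢left)
    where
    j≢right : j ≢ right
    j≢right refl = <-asym j<left left<right
    j≢left : j ≢ left
    j≢left refl = <-irrefl refl j<left

  swapAt-nearOrder : (σ : Permutation′ n) → ¬ Near k (σ ⟨$⟩ʳ left) (σ ⟨$⟩ʳ right) →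
                     PreservesNearOrder k σ (swapAt σ)
  swapAt-nearOrder σ far a b _ _ near σab =
    transpose-adjacent-< left right left<right right≤1+left σab λ (σa≡left , σb≡right) →
      far (subst₂ (Near _) (sym (position≡⇒value σ (cong toℕ σa≡left)))
                           (sym (position≡⇒value σ (cong toℕ σb≡right))) near)
    where
    right≤1+left : toℕ right ≤ suc (toℕ left)
    right≤1+left = ≤-reflexive (trans toℕ-right (cong suc (sym toℕ-left)))

  swapAt-recoilEq : (σ : Permutation′ n) → ¬ Near k (σ ⟨$⟩ʳ left) (σ ⟨$⟩ʳ right) → swapAt σ ≡[ k ] σ
  swapAt-recoilEq σ far =
    nearOrder⇒recoilEq (swapAt σ) σ (nearOrder-sym σ (swapAt σ) (swapAt-nearOrder σ far))

isMin⇒noBigDescent : 1 ≤ k → (σ : Permutation′ n) → IsMinInClass k σ → NoBigDescent k σ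
isMin⇒noBigDescent {k} 1≤k σ min i i+1<n big =
  <lex⇒≱lex σ (swapAt σ)
    (left , swapAt-agreeBefore σ , subst (_< oneLine σ left) (sym (oneLine-swapAt-left σ)) descent)
    (min (swapAt σ) (swapAt-recoilEq σ far))
  where
  open AdjacentSwap i i+1<n
  descent : oneLine σ right < oneLine σ left
  descent = <-≤-trans (m<m+n _ 1≤k) big
  far : ¬ Near k (σ ⟨$⟩ʳ left) (σ ⟨$⟩ʳ right)
  far (left<right+k , _) = <⇒≱ left<right+k (s≤s⁻¹ big)

isMax⇒noBigAscent : 1 ≤ k → (σ : Permutation′ n) → IsMaxInClass k σ → NoBigAscent k σ
isMax⇒noBigAscent {k} 1≤k σ max i i+1<n big =
  <lex⇒≱lex (swapAt σ) σ
    (left , agreeBefore-sym (swapAt σ) σ (swapAt-agreeBefore σ) ,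
     subst (oneLine σ left <_) (sym (oneLine-swapAt-left σ)) ascent)
    (max (swapAt σ) (swapAt-recoilEq σ far))
  where
  open AdjacentSwap i i+1<n
  ascent : oneLine σ left < oneLine σ right
  ascent = <-≤-trans (m<m+n _ 1≤k) big
  far : ¬ Near k (σ ⟨$⟩ʳ left) (σ ⟨$⟩ʳ right)
  far (_ , right<left+k) = <⇒≱ right<left+k (s≤s⁻¹ big)

complement : Permutation′ n → Permutation′ n
complement σ = σ ∘ₚ reverse

Complementary : Permutation′ n → Permutation′ n → Set
Complementary {n} σ τ = ∀ i → oneLine σ i ≡ suc n ∸ oneLine τ i

oneLine≤ : (σ : Permutation′ n) (i : Fin n) → oneLine σ i ≤ suc n
oneLine≤ σ i = s≤s (<⇒≤ (toℕ<n (σ ⟨$⟩ʳ i)))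

complement-complementary : (σ : Permutation′ n) → Complementary (complement σ) σ
complement-complementary σ i =
  trans (cong suc (opposite-prop (σ ⟨$⟩ʳ i))) (sym (+-∸-assoc 1 (toℕ<n (σ ⟨$⟩ʳ i))))

complementary-complement : (σ : Permutation′ n) → Complementary σ (complement σ)
complementary-complement {n} σ i =
  sym (trans (cong (suc n ∸_) (complement-complementary σ i)) (m∸[m∸n]≡n (oneLine≤ σ i)))

complement-cancel : (σ τ : Permutation′ n) (i : Fin n) →
                    oneLine (complement σ) i ≡ oneLine (complement τ) i → oneLine τ i ≡ oneLine σ i
complement-cancel σ τ i e = sym (∸-cancelˡ-≡ (oneLine≤ σ i) (oneLine≤ τ i)
  (trans (sym (complement-complementary σ i)) (trans e (complement-complementary τ i))))

complement-≤lex : (σ τ : Permutation′ n) → complement σ ≤lex complement τ → τ ≤lex σ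
complement-≤lex σ τ (inj₁ same) = inj₁ λ i → complement-cancel σ τ i (same i)
complement-≤lex {n} σ τ (inj₂ (i , agree , lt)) =
  inj₂ (i , (λ j j<i → complement-cancel σ τ j (agree j j<i)) ,
        ∸-cancelʳ-< {o = suc n}
          (subst₂ _<_ (complement-complementary σ i) (complement-complementary τ i) lt))

+-trade-< : ∀ {x y a b} → x + a ≡ y + b → a < b + k → y < x + k
+-trade-< {k} {x} {y} {a} {b} x+a≡y+b a<b+k = +-cancelʳ-< b y (x + k) (begin-strict
  y + b       ≡⟨ x+a≡y+b ⟨
  x + a       <⟨ +-monoʳ-< x a<b+k ⟩
  x + (b + k) ≡⟨ cong (λ z → x + z) (+-comm b k) ⟩
  x + (k + b) ≡⟨ +-assoc x k b ⟨
  x + k + b   ∎)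
  where open ≤-Reasoning

opposite-sum : (a : Fin n) → suc (toℕ (opposite a) + toℕ a) ≡ n
opposite-sum {n} a = begin
  suc (toℕ (opposite a) + toℕ a) ≡⟨ +-suc _ (toℕ a) ⟨
  toℕ (opposite a) + suc (toℕ a) ≡⟨ cong (_+ suc (toℕ a)) (opposite-prop a) ⟩
  n ∸ suc (toℕ a) + suc (toℕ a)  ≡⟨ m∸n+n≡m (toℕ<n a) ⟩
  n                              ∎
  where open ≡-Reasoning

near-opposite : {a b : Fin n} → Near k a b → Near k (opposite a) (opposite b)
near-opposite {a = a} {b} (a<b+k , b<a+k) = +-trade-< (sum≡ b a) b<a+k , +-trade-< (sum≡ a b) a<b+k
  where
  sum≡ : ∀ u v → toℕ (opposite u) + toℕ u ≡ toℕ (opposite v) + toℕ v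
  sum≡ u v = suc-injective (trans (opposite-sum u) (sym (opposite-sum v)))

nearOrder-complement : (σ τ : Permutation′ n) → PreservesNearOrder k σ τ →
                       PreservesNearOrder k (complement σ) (complement τ)
nearOrder-complement σ τ pres a b _ _ near =
  pres (opposite a) (opposite b) (toℕ<n (opposite a)) (toℕ<n (opposite b)) (near-opposite near)

isMin-complement⇒isMax : (σ : Permutation′ n) → IsMinInClass k (complement σ) → IsMaxInClass k σ
isMin-complement⇒isMax {k = k} σ min τ τ≡σ = complement-≤lex σ τ (min (complement τ)
  (nearOrder⇒recoilEq (complement τ) (complement σ)
    (nearOrder-complement τ σ (recoilEq⇒nearOrder {k = k} τ σ τ≡σ))))

∸-gap : ∀ {N a b} → a ≤ N → b ≤ N → N ∸ b + k ≤ N ∸ a → a + k ≤ b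
∸-gap {k} {N} {a} {b} a≤N b≤N gap = +-cancelˡ-≤ (N ∸ b) (a + k) b (begin
  N ∸ b + (a + k) ≡⟨ cong (λ z → N ∸ b + z) (+-comm a k) ⟩
  N ∸ b + (k + a) ≡⟨ +-assoc (N ∸ b) k a ⟨
  N ∸ b + k + a   ≤⟨ +-monoˡ-≤ a gap ⟩
  N ∸ a + a       ≡⟨ m∸n+n≡m a≤N ⟩
  N               ≡⟨ m∸n+n≡m b≤N ⟨
  N ∸ b + b       ∎)
  where open ≤-Reasoning

complementary-noBigDescent : (σ τ : Permutation′ n) → Complementary σ τ →
                             NoBigDescent k τ → NoBigAscent k σ
complementary-noBigDescent {k = k} σ τ σ≡n+1-τ nbd i i+1<n ascent =
  nbd i i+1<n (∸-gap (oneLine≤ τ _) (oneLine≤ τ _)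
    (subst₂ (λ u v → u + k ≤ v) (σ≡n+1-τ _) (σ≡n+1-τ _) ascent))

complementary-noBigAscent : (σ τ : Permutation′ n) → Complementary σ τ →
                            NoBigAscent k τ → NoBigDescent k σ
complementary-noBigAscent {k = k} σ τ σ≡n+1-τ nba i i+1<n descent =
  nba i i+1<n (∸-gap (oneLine≤ τ _) (oneLine≤ τ _)
    (subst₂ (λ u v → u + k ≤ v) (σ≡n+1-τ _) (σ≡n+1-τ _) descent))

noBigAscent⇒noBigDescent-complement : (σ : Permutation′ n) →
                                      NoBigAscent k σ → NoBigDescent k (complement σ)
noBigAscent⇒noBigDescent-complement σ =
  complementary-noBigAscent (complement σ) σ (complement-complementary σ)

noBigAscent⇒isMax : (σ : Permutation′ n) → NoBigAscent k σ → IsMaxInClass k σ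
noBigAscent⇒isMax {k = k} σ nba =
  isMin-complement⇒isMax {k = k} σ
    (noBigDescent⇒isMin (complement σ) (noBigAscent⇒noBigDescent-complement σ nba))

isMax⇒isMin-complement : 1 ≤ k → (σ : Permutation′ n) →
                         IsMaxInClass k σ → IsMinInClass k (complement σ)
isMax⇒isMin-complement 1≤k σ max = noBigDescent⇒isMin (complement σ)
  (noBigAscent⇒noBigDescent-complement σ (isMax⇒noBigAscent 1≤k σ max))

mainTheorem3 : (k n : ℕ) → 1 ≤ k → 1 ≤ n →
    ((σ : Permutation′ n) → IsMinInClass k σ ⇔ NoBigDescent k σ)
    × ((σ : Permutation′ n) → IsMaxInClass k σ ⇔ NoBigAscent k σ)
    × ((σ : Permutation′ n) → IsMaxInClass k σ ⇔
         Σ (Permutation′ n) (λ τ → IsMinInClass k τ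
           × (∀ i → oneLine σ i ≡ suc n ∸ oneLine τ i)))
mainTheorem3 k n 1≤k _ =
  (λ σ → mk⇔ (isMin⇒noBigDescent 1≤k σ) (noBigDescent⇒isMin σ)) ,
  (λ σ → mk⇔ (isMax⇒noBigAscent 1≤k σ) (noBigAscent⇒isMax σ)) ,
  (λ σ → mk⇔ (λ max → complement σ , isMax⇒isMin-complement 1≤k σ max , complementary-complement σ)
             (λ (τ , min , σ≡n+1-τ) → noBigAscent⇒isMax σ
               (complementary-noBigDescent σ τ σ≡n+1-τ (isMin⇒noBigDescent 1≤k τ min))))
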